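{- Let $\mathbf t$ be the Thue--Morse word and $P_{\mathbf t}(n)=\sum_{i=0}^{n-1}p_{\mathbf t}(i)$. Then for every integer $n\ge 1$, \[ \frac38 (n-1)^2 + \frac{n}{2} \le P_{\mathbf t}(n) \le \frac34 n^2+n+1.\]
   Context: The Thue--Morse word $\mathbf t=t_0t_1t_2\cdots$ over $\{0,1\}$ is defined by $t_i=0$ if the number of $1$'s in the binary representation of $i$ is even, and $t_i=1$ otherwise. For an infinite word $\mathbf w=w_0w_1w_2\cdots$, the periodicity function $p_{\mathbf w}(i)$ is the length of the shortest nonempty prefix $u$ of $w_iw_{i+1}w_{i+2}\cdots$ such that either $u$ is a suffix of $w_0\cdots w_{i-1}$ or $w_0\cdots w_{i-1}$ is a suffix of $u$ (for $i=0$, $w_0\cdots w_{i-1}$ is the empty word); if no such $u$ exists, $p_{\mathbf w}(i)=\infty$ (this does not occur for recurrent words such as $\mathbf t$). -}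

module Defs where

open import Data.Nat using (ℕ; zero; suc; _+_; _*_; _<_; _≤_; _/_; _%_)
open import Data.Bool using (Bool; true; false; not)
open import Data.List using (List; []; _∷_; _++_; map)
open import Data.Product using (∃; _×_)
open import Data.Sum using (_⊎_)
open import Relation.Binary.PropositionalEquality using (_≡_)

-- Parity of the number of 1's in the binary representation of n
-- (true = odd).  The fuel argument k (with k ≥ n) only ensures termination:
-- n / 2 < n for n ≥ 1, so fuel n suffices.
oddOnes : ℕ → ℕ → Bool
oddOnes zero    n = false
oddOnes (suc k) zero = false
oddOnes (suc k) n@(suc _) with n % 2
... | zero  = oddOnes k (n / 2)
... | suc _ = not (oddOnes k (n / 2))

t : ℕ → ℕ
t i with oddOnes i i
... | false = 0
... | true  = 1

factor : (ℕ → ℕ) → ℕ → ℕ → List ℕ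
factor w i zero    = []
factor w i (suc ℓ) = w i ∷ factor w (suc i) ℓ

prefix : (ℕ → ℕ) → ℕ → List ℕ
prefix w i = factor w 0 i

IsSuffix : List ℕ → List ℕ → Set
IsSuffix x y = ∃ λ v → v ++ x ≡ y

Admissible : (ℕ → ℕ) → ℕ → ℕ → Set
Admissible w i ℓ =
  1 ≤ ℓ × (IsSuffix (factor w i ℓ) (prefix w i) ⊎ IsSuffix (prefix w i) (factor w i ℓ))

-- p_w(i) = ℓ  (ℓ finite): ℓ is the least admissible length.
IsPeriodicity : (ℕ → ℕ) → ℕ → ℕ → Set
IsPeriodicity w i ℓ = Admissible w i ℓ × (∀ m → Admissible w i m → ℓ ≤ m)

sumTo : (ℕ → ℕ) → ℕ → ℕ
sumTo f zero    = 0
sumTo f (suc n) = sumTo f n + f n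

-- Since t is a concatenation of the blocks 01 and 10, an even
-- position has p_t(2a) ∈ {1, 2}.  For an odd position i with 2^k ≤ i < 2^(k+1) we get
-- p_t(i) = 3·2^k: the prefix of length 2^(k+1) recurs at 3·2^k, and no shorter length works.
-- A shorter length would give either a square of t centred at the odd position i, which
-- halves to an overlap or forces an overlap of period 2, while t is overlap-free; or a
-- recurrence of a prefix of length > 2^k at some m < 3·2^k, but such recurrences lie at
-- multiples of 2^k, and t(2^(k+1)) ≠ t(0).
-- Summing p_t(2a) + p_t(2a + 1) ∈ [3a + 4, 6a + 5] over the pairs gives the estimate.
module Submission where

open import Defs
open import Data.Bool.Base using (Bool; true; false; not; _xor_)
open import Data.Bool.Properties
  using (¬-not; not-involutive; not-injective; not-¬; xor-identityʳ; not-distribʳ-xor) renaming (_≟_ to _≟ᵇ_)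
open import Data.Empty using (⊥-elim)
open import Data.List.Base using (List; []; _∷_; _++_; length)
open import Data.List.Properties using (length-++; ∷-injectiveˡ; ∷-injectiveʳ)
open import Data.Nat.Base hiding (parity)
open import Data.Nat.Properties
open import Data.Nat.Induction using (<-wellFounded)
open import Data.Nat.DivMod using (_/_; _%_; m*n/n≡m; m*n%n≡0; [m+kn]%n≡m%n; +-distrib-/; m/n<m)
open import Data.Nat.Divisibility using (_∣_; divides; *-monoʳ-∣; 1∣_)
open import Data.Nat.Tactic.RingSolver using (solve-∀)
open import Data.Product.Base using (∃; _×_; _,_; proj₁; proj₂)
open import Data.Sum.Base using (inj₁; inj₂)
open import Function.Base using (_∘_)
open import Function.Bundles using (_⇔_; mk⇔; Equivalence)
open import Induction.WellFounded using (Acc; acc)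
open import Relation.Binary.PropositionalEquality
open import Relation.Nullary using (¬_; yes; no; contradiction)

open Equivalence using (to; from)

data Parity : ℕ → Set where
  even : ∀ a → Parity (2 * a)
  odd  : ∀ a → Parity (suc (2 * a))

parity : ∀ n → Parity n
parity zero = even 0
parity (suc n) with parity n
... | even a = odd a
... | odd a  = subst Parity (*-suc 2 a) (even (suc a))

≤-by-slack : ∀ {m n} k → m + k ≡ n → m ≤ n
≤-by-slack k refl = m≤m+n _ k

-- Factors and periods of infinite words

module _ {A : Set} (w : ℕ → A) where

  -- A record rather than a function type so that its indices can be inferred.
  record Agree (i j ℓ : ℕ) : Set where
    constructor agree
    field
      at : ∀ k → k < ℓ → w (i + k) ≡ w (j + k)

  open Agree public

  -- The factor of length p + L starting at x has period p.
  Periodic : ℕ → ℕ → ℕ → Set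
  Periodic x p L = Agree x (x + p) L

  Agree-sym : ∀ {i j ℓ} → Agree i j ℓ → Agree j i ℓ
  Agree-sym h .at k k<ℓ = sym (h .at k k<ℓ)

  Periodic-suc : ∀ {x p L} → Periodic x p (suc L) → Periodic (suc x) p L
  Periodic-suc {x} {p} per .at k k<L = subst₂ (λ i j → w i ≡ w j)
    (+-suc x k) (+-suc (x + p) k) (per .at (suc k) (s≤s k<L))

  Periodic-1⇔ : ∀ {x} → Periodic x 1 1 ⇔ w x ≡ w (suc x)
  Periodic-1⇔ {x} = mk⇔ (λ per → subst₂ (λ i j → w i ≡ w j) x+0≡x x+1+0≡1+x (per .at 0 z<s))
    (λ eq → agree λ { zero _ → subst₂ (λ i j → w i ≡ w j) (sym x+0≡x) (sym x+1+0≡1+x) eq ; (suc _) (s≤s ()) })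
    where
    x+0≡x : x + 0 ≡ x
    x+0≡x = +-identityʳ x
    x+1+0≡1+x : x + 1 + 0 ≡ suc x
    x+1+0≡1+x = trans (+-identityʳ (x + 1)) (+-comm x 1)

  Agree-≤ : ∀ {i j ℓ ℓ′} → ℓ′ ≤ ℓ → Agree i j ℓ → Agree i j ℓ′
  Agree-≤ ℓ′≤ℓ h .at k k<ℓ′ = h .at k (<-≤-trans k<ℓ′ ℓ′≤ℓ)

++-cancel-length : ∀ {A : Set} (u v : List A) {x y} → length u ≡ length v → u ++ x ≡ v ++ y → x ≡ y
++-cancel-length []      []      _   eq = eq
++-cancel-length (_ ∷ u) (_ ∷ v) len eq = ++-cancel-length u v (suc-injective len) (∷-injectiveʳ eq)

module _ (w : ℕ → ℕ) where

  length-factor : ∀ i ℓ → length (factor w i ℓ) ≡ ℓ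
  length-factor i zero    = refl
  length-factor i (suc ℓ) = cong suc (length-factor (suc i) ℓ)

  factor-+ : ∀ i a b → factor w i (a + b) ≡ factor w i a ++ factor w (i + a) b
  factor-+ i zero    b = cong (λ j → factor w j b) (sym (+-identityʳ i))
  factor-+ i (suc a) b = cong (w i ∷_) (trans (factor-+ (suc i) a b)
    (cong (λ j → factor w (suc i) a ++ factor w j b) (sym (+-suc i a))))

  factor-≡⇔Agree : ∀ i j ℓ → factor w i ℓ ≡ factor w j ℓ ⇔ Agree w i j ℓ
  factor-≡⇔Agree i j ℓ = mk⇔ (⇒ i j ℓ) (⇐ i j ℓ)
    where
    ⇒ : ∀ i j ℓ → factor w i ℓ ≡ factor w j ℓ → Agree w i j ℓ
    ⇒ i j (suc ℓ) eq .at zero    _         = subst₂ (λ x y → w x ≡ w y)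
      (sym (+-identityʳ i)) (sym (+-identityʳ j)) (∷-injectiveˡ eq)
    ⇒ i j (suc ℓ) eq .at (suc k) (s≤s k<ℓ) = subst₂ (λ x y → w x ≡ w y)
      (sym (+-suc i k)) (sym (+-suc j k)) (⇒ (suc i) (suc j) ℓ (∷-injectiveʳ eq) .at k k<ℓ)
    ⇐ : ∀ i j ℓ → Agree w i j ℓ → factor w i ℓ ≡ factor w j ℓ
    ⇐ i j zero    h = refl
    ⇐ i j (suc ℓ) h = cong₂ _∷_
      (subst₂ (λ x y → w x ≡ w y) (+-identityʳ i) (+-identityʳ j) (h .at 0 z<s))
      (⇐ (suc i) (suc j) ℓ (agree λ k k<ℓ → subst₂ (λ x y → w x ≡ w y)
        (+-suc i k) (+-suc j k) (h .at (suc k) (s<s k<ℓ))))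

  length-++-factor : ∀ v x j n → v ++ x ≡ factor w j n → length v + length x ≡ n
  length-++-factor v x j n eq = trans (sym (length-++ v)) (trans (cong length eq) (length-factor j n))

  suffix-of-prefix⇔square : ∀ i ℓ →
    IsSuffix (factor w i ℓ) (prefix w i) ⇔ ∃ λ s → s + ℓ ≡ i × Periodic w s ℓ ℓ
  suffix-of-prefix⇔square i ℓ = mk⇔ ⇒ ⇐
    where
    ⇒ : IsSuffix (factor w i ℓ) (prefix w i) → ∃ λ s → s + ℓ ≡ i × Periodic w s ℓ ℓ
    ⇒ (v , eq) = s , s+ℓ≡i , subst (λ j → Agree w s j ℓ) (sym s+ℓ≡i) (Agree-sym w agreement)
      where
      s = length v
      s+ℓ≡i : s + ℓ ≡ i
      s+ℓ≡i = trans (cong (s +_) (sym (length-factor i ℓ))) (length-++-factor v _ 0 i eq)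
      agreement : Agree w i s ℓ
      agreement = to (factor-≡⇔Agree i s ℓ) (++-cancel-length v (factor w 0 s)
        (sym (length-factor 0 s))
        (trans eq (trans (cong (factor w 0) (sym s+ℓ≡i)) (factor-+ 0 s ℓ))))
    ⇐ : (∃ λ s → s + ℓ ≡ i × Periodic w s ℓ ℓ) → IsSuffix (factor w i ℓ) (prefix w i)
    ⇐ (s , s+ℓ≡i , per) = factor w 0 s , (begin
      factor w 0 s ++ factor w i ℓ        ≡⟨ cong (λ j → factor w 0 s ++ factor w j ℓ) s+ℓ≡i ⟨
      factor w 0 s ++ factor w (s + ℓ) ℓ  ≡⟨ cong (factor w 0 s ++_) (from (factor-≡⇔Agree s (s + ℓ) ℓ) per) ⟨
      factor w 0 s ++ factor w s ℓ        ≡⟨ factor-+ 0 s ℓ ⟨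
      factor w 0 (s + ℓ)                  ≡⟨ cong (factor w 0) s+ℓ≡i ⟩
      factor w 0 i                        ∎)
      where open ≡-Reasoning

  prefix-is-suffix⇔recurrence : ∀ i ℓ →
    IsSuffix (prefix w i) (factor w i ℓ) ⇔ (i ≤ ℓ × Periodic w 0 ℓ i)
  prefix-is-suffix⇔recurrence i ℓ = mk⇔ ⇒ ⇐
    where
    ⇒ : IsSuffix (prefix w i) (factor w i ℓ) → i ≤ ℓ × Periodic w 0 ℓ i
    ⇒ (v , eq) = ≤-by-slack r i+r≡ℓ , subst (λ j → Agree w 0 j i) i+r≡ℓ agreement
      where
      r = length v
      i+r≡ℓ : i + r ≡ ℓ
      i+r≡ℓ = trans (+-comm i r) (trans (cong (r +_) (sym (length-factor 0 i)))
        (length-++-factor v _ i ℓ eq))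
      agreement : Agree w 0 (i + r) i
      agreement = to (factor-≡⇔Agree 0 (i + r) i) (++-cancel-length v (factor w i r)
        (sym (length-factor i r))
        (trans eq (trans (cong (factor w i) (trans (sym i+r≡ℓ) (+-comm i r))) (factor-+ i r i))))
    ⇐ : i ≤ ℓ × Periodic w 0 ℓ i → IsSuffix (prefix w i) (factor w i ℓ)
    ⇐ (i≤ℓ , per) = factor w i r , (begin
      factor w i r ++ factor w 0 i        ≡⟨ cong (factor w i r ++_) (from (factor-≡⇔Agree 0 (i + r) i) per′) ⟩
      factor w i r ++ factor w (i + r) i  ≡⟨ factor-+ i r i ⟨
      factor w i (r + i)                  ≡⟨ cong (factor w i) (m∸n+n≡m i≤ℓ) ⟩
      factor w i ℓ                        ∎)
      where
      open ≡-Reasoning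
      r = ℓ ∸ i
      per′ : Agree w 0 (i + r) i
      per′ = subst (λ j → Agree w 0 j i) (sym (m+[n∸m]≡n i≤ℓ)) per

-- The Thue–Morse word as a Boolean sequence

tm : ℕ → Bool
tm i = oddOnes i i

t≡⇔tm≡ : ∀ i j → t i ≡ t j ⇔ tm i ≡ tm j
t≡⇔tm≡ i j with oddOnes i i | oddOnes j j
... | false | false = mk⇔ (λ _ → refl) (λ _ → refl)
... | false | true  = mk⇔ (λ ()) (λ ())
... | true  | false = mk⇔ (λ ()) (λ ())
... | true  | true  = mk⇔ (λ _ → refl) (λ _ → refl)

Agree-t⇔tm : ∀ i j ℓ → Agree t i j ℓ ⇔ Agree tm i j ℓ
Agree-t⇔tm i j ℓ = mk⇔
  (λ h → agree λ k k<ℓ → to (t≡⇔tm≡ (i + k) (j + k)) (h .at k k<ℓ))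
  (λ h → agree λ k k<ℓ → from (t≡⇔tm≡ (i + k) (j + k)) (h .at k k<ℓ))

suc-/2≤ : ∀ n → suc n / 2 ≤ n
suc-/2≤ n = <⇒≤pred (m/n<m (suc n) 2 (s≤s (s≤s z≤n)))

2*n%2≡0 : ∀ n → 2 * n % 2 ≡ 0
2*n%2≡0 n = trans (cong (_% 2) (*-comm 2 n)) (m*n%n≡0 n 2)

2*n/2≡n : ∀ n → 2 * n / 2 ≡ n
2*n/2≡n n = trans (cong (_/ 2) (*-comm 2 n)) (m*n/n≡m n 2)

[1+2*n]%2≡1 : ∀ n → suc (2 * n) % 2 ≡ 1
[1+2*n]%2≡1 n = trans (cong (λ m → suc m % 2) (*-comm 2 n)) ([m+kn]%n≡m%n 1 n 2)

[1+2*n]/2≡n : ∀ n → suc (2 * n) / 2 ≡ n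
[1+2*n]/2≡n n = trans (cong (λ m → suc m / 2) (*-comm 2 n))
  (trans (+-distrib-/ 1 (n * 2) {2} (subst (λ r → 1 + r < 2) (sym (m*n%n≡0 n 2)) ≤-refl))
    (m*n/n≡m n 2))

flipIf : ℕ → Bool → Bool
flipIf zero    b = b
flipIf (suc _) b = not b

oddOnes-suc : ∀ k n → oddOnes (suc k) (suc n) ≡ flipIf (suc n % 2) (oddOnes k (suc n / 2))
oddOnes-suc k n with suc n % 2
... | zero  = refl
... | suc _ = refl

oddOnes-fuel : ∀ {k k′} n → n ≤ k → n ≤ k′ → oddOnes k n ≡ oddOnes k′ n
oddOnes-fuel {zero}  {zero}  zero _ _ = refl
oddOnes-fuel {zero}  {suc _} zero _ _ = refl
oddOnes-fuel {suc _} {zero}  zero _ _ = refl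
oddOnes-fuel {suc _} {suc _} zero _ _ = refl
oddOnes-fuel {suc k} {suc k′} (suc n) (s≤s n≤k) (s≤s n≤k′) = begin
  oddOnes (suc k) (suc n)                      ≡⟨ oddOnes-suc k n ⟩
  flipIf (suc n % 2) (oddOnes k (suc n / 2))   ≡⟨ cong (flipIf (suc n % 2)) (oddOnes-fuel (suc n / 2) half≤k half≤k′) ⟩
  flipIf (suc n % 2) (oddOnes k′ (suc n / 2))  ≡⟨ oddOnes-suc k′ n ⟨
  oddOnes (suc k′) (suc n)                     ∎
  where
  open ≡-Reasoning
  half≤k : suc n / 2 ≤ k
  half≤k = ≤-trans (suc-/2≤ n) n≤k
  half≤k′ : suc n / 2 ≤ k′
  half≤k′ = ≤-trans (suc-/2≤ n) n≤k′

tm-halve : ∀ n → 0 < n → tm n ≡ flipIf (n % 2) (tm (n / 2))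
tm-halve (suc n) _ = trans (oddOnes-suc n n) (cong (flipIf (suc n % 2))
  (oddOnes-fuel (suc n / 2) (suc-/2≤ n) ≤-refl))

tm-double : ∀ a → tm (2 * a) ≡ tm a
tm-double zero    = refl
tm-double (suc a) = trans (tm-halve (2 * suc a) z<s) (cong₂ flipIf (2*n%2≡0 (suc a)) (cong tm (2*n/2≡n (suc a))))

tm-suc-double : ∀ a → tm (suc (2 * a)) ≡ not (tm a)
tm-suc-double a = trans (tm-halve (suc (2 * a)) z<s) (cong₂ flipIf ([1+2*n]%2≡1 a) (cong tm ([1+2*n]/2≡n a)))

tm-pair : ∀ a → tm (suc (2 * a)) ≡ not (tm (2 * a))
tm-pair a = trans (tm-suc-double a) (cong not (sym (tm-double a)))

tm-xor : ∀ k q j → j < 2 ^ k → tm (q * 2 ^ k + j) ≡ tm q xor tm j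
tm-xor zero    q zero    _ = trans (cong tm (trans (+-identityʳ _) (*-identityʳ q))) (sym (xor-identityʳ (tm q)))
tm-xor zero    q (suc j) (s≤s ())
tm-xor (suc k) q j j<2P with parity j
... | even j′ = begin
  tm (q * (2 * P) + 2 * j′)   ≡⟨ cong tm (shift q j′ P) ⟩
  tm (2 * (q * P + j′))       ≡⟨ tm-double (q * P + j′) ⟩
  tm (q * P + j′)             ≡⟨ tm-xor k q j′ (*-cancelˡ-< 2 j′ P j<2P) ⟩
  tm q xor tm j′              ≡⟨ cong (tm q xor_) (tm-double j′) ⟨
  tm q xor tm (2 * j′)        ∎
  where
  open ≡-Reasoning
  P = 2 ^ k
  shift : ∀ q j′ P → q * (2 * P) + 2 * j′ ≡ 2 * (q * P + j′)
  shift = solve-∀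
... | odd j′ = begin
  tm (q * (2 * P) + suc (2 * j′))   ≡⟨ cong tm (shift q j′ P) ⟩
  tm (suc (2 * (q * P + j′)))       ≡⟨ tm-suc-double (q * P + j′) ⟩
  not (tm (q * P + j′))             ≡⟨ cong not (tm-xor k q j′ (*-cancelˡ-< 2 j′ P (<⇒≤ j<2P))) ⟩
  not (tm q xor tm j′)              ≡⟨ not-distribʳ-xor (tm q) (tm j′) ⟩
  tm q xor not (tm j′)              ≡⟨ cong (tm q xor_) (tm-suc-double j′) ⟨
  tm q xor tm (suc (2 * j′))        ∎
  where
  open ≡-Reasoning
  P = 2 ^ k
  shift : ∀ q j′ P → q * (2 * P) + suc (2 * j′) ≡ suc (2 * (q * P + j′))
  shift = solve-∀

halve-even : ∀ {a b L} → Periodic tm (2 * a) (2 * b) (suc (2 * L)) → Periodic tm a b (suc L)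
halve-even {a} {b} {L} per .at k k<1+L = begin
  tm (a + k)                  ≡⟨ tm-double (a + k) ⟨
  tm (2 * (a + k))            ≡⟨ cong tm (*-distribˡ-+ 2 a k) ⟩
  tm (2 * a + 2 * k)          ≡⟨ per .at (2 * k) (s≤s (*-monoʳ-≤ 2 (≤-pred k<1+L))) ⟩
  tm (2 * a + 2 * b + 2 * k)  ≡⟨ cong tm (double a b k) ⟩
  tm (2 * (a + b + k))        ≡⟨ tm-double (a + b + k) ⟩
  tm (a + b + k)              ∎
  where
  open ≡-Reasoning
  double : ∀ a b k → 2 * a + 2 * b + 2 * k ≡ 2 * (a + b + k)
  double = solve-∀

halve-odd : ∀ {a b L} → Periodic tm (suc (2 * a)) (2 * b) (2 * suc L) → Periodic tm a b (suc (suc L))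
halve-odd {a} {b} {L} per .at zero _ = not-injective (begin
  not (tm (a + 0))                  ≡⟨ tm-suc-double (a + 0) ⟨
  tm (suc (2 * (a + 0)))            ≡⟨ cong tm (shift₀ a) ⟩
  tm (suc (2 * a) + 0)              ≡⟨ per .at 0 z<s ⟩
  tm (suc (2 * a) + 2 * b + 0)      ≡⟨ cong tm (shift₁ a b) ⟩
  tm (suc (2 * (a + b + 0)))        ≡⟨ tm-suc-double (a + b + 0) ⟩
  not (tm (a + b + 0))              ∎)
  where
  open ≡-Reasoning
  shift₀ : ∀ a → suc (2 * (a + 0)) ≡ suc (2 * a) + 0
  shift₀ = solve-∀
  shift₁ : ∀ a b → suc (2 * a) + 2 * b + 0 ≡ suc (2 * (a + b + 0))
  shift₁ = solve-∀
halve-odd {a} {b} {L} per .at (suc k) (s≤s k<1+L) = begin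
  tm (a + suc k)                        ≡⟨ tm-double (a + suc k) ⟨
  tm (2 * (a + suc k))                  ≡⟨ cong tm (shift₀ a k) ⟩
  tm (suc (2 * a) + suc (2 * k))        ≡⟨ per .at (suc (2 * k)) 1+2k<2+2L ⟩
  tm (suc (2 * a) + 2 * b + suc (2 * k)) ≡⟨ cong tm (shift₁ a b k) ⟩
  tm (2 * (a + b + suc k))              ≡⟨ tm-double (a + b + suc k) ⟩
  tm (a + b + suc k)                    ∎
  where
  open ≡-Reasoning
  shift₀ : ∀ a k → 2 * (a + suc k) ≡ suc (2 * a) + suc (2 * k)
  shift₀ = solve-∀
  shift₁ : ∀ a b k → suc (2 * a) + 2 * b + suc (2 * k) ≡ 2 * (a + b + suc k)
  shift₁ = solve-∀
  1+2k<2+2L : suc (2 * k) < 2 * suc L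
  1+2k<2+2L = subst (_≤ 2 * suc L) (*-suc 2 k) (*-monoʳ-≤ 2 k<1+L)

-- Overlap-freeness

module _ (w : ℕ → Bool) where

  Flips : ℕ → Set
  Flips x = w (suc x) ≡ not (w x)

  Alternating : ℕ → ℕ → Set
  Alternating z n = ∀ k → k < n → Flips (z + k)

  Periodic⇒Flips⇔ : ∀ {x p L k} → Periodic w x p (suc L) → k < L → Flips (x + k) ⇔ Flips (x + p + k)
  Periodic⇒Flips⇔ {x} {p} {L} {k} per k<L = mk⇔
    (λ f → trans (sym next) (trans f (cong not here)))
    (λ f → trans next (trans f (cong not (sym here))))
    where
    here : w (x + k) ≡ w (x + p + k)
    here = per .at k (m<n⇒m<1+n k<L)
    next : w (suc (x + k)) ≡ w (suc (x + p + k))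
    next = subst₂ (λ i j → w i ≡ w j) (+-suc x k) (+-suc (x + p) k) (per .at (suc k) (s≤s k<L))

  Alternating-≤ : ∀ {z m n} → m ≤ n → Alternating z n → Alternating z m
  Alternating-≤ m≤n alt k k<m = alt k (<-≤-trans k<m m≤n)

  Flips⇒¬Periodic-1 : ∀ {x} → Flips x → ¬ Periodic w x 1 1
  Flips⇒¬Periodic-1 f per = not-¬ refl (trans (to (Periodic-1⇔ w) per) f)

  Alternating-shift : ∀ {x p L} → Periodic w x p (suc L) → Alternating x L → Alternating (x + p) L
  Alternating-shift per alt k k<L = to (Periodic⇒Flips⇔ per k<L) (alt k k<L)

  Alternating-++ : ∀ {z m n} → Alternating z m → Alternating (z + m) n → Alternating z (m + n)
  Alternating-++ {z} {m} {n} alt₁ alt₂ k k<m+n with k <? m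
  ... | yes k<m = alt₁ k k<m
  ... | no k≮m = subst Flips (trans (+-assoc z m d) (cong (z +_) m+d≡k))
    (alt₂ d (+-cancelˡ-< m d n (subst (_< m + n) (sym m+d≡k) k<m+n)))
    where
    d = k ∸ m
    m+d≡k : m + d ≡ k
    m+d≡k = m+[n∸m]≡n (≮⇒≥ k≮m)

  Alternating⇒Periodic : ∀ {z L} → Alternating z (suc L) → Periodic w z 2 L
  Alternating⇒Periodic {z} {L} alt .at k k<L = begin
    w (z + k)                 ≡⟨ not-involutive (w (z + k)) ⟨
    not (not (w (z + k)))     ≡⟨ cong not (alt k (m<n⇒m<1+n k<L)) ⟨
    not (w (suc (z + k)))     ≡⟨ cong (λ i → not (w i)) (+-suc z k) ⟨
    not (w (z + suc k))       ≡⟨ alt (suc k) (s≤s k<L) ⟨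
    w (suc (z + suc k))       ≡⟨ cong w (sym (shift z k)) ⟩
    w (z + 2 + k)             ∎
    where
    open ≡-Reasoning
    shift : ∀ z k → z + 2 + k ≡ suc (z + suc k)
    shift = solve-∀

-- Of the positions x + k and x + p + k one is even, so it starts one of the blocks 01, 10.
odd-period⇒Alternating : ∀ {x c L} → Periodic tm x (suc (2 * c)) (suc L) → Alternating tm x L
odd-period⇒Alternating {x} {c} per k k<L with x + k in x+k≡n
... | n with parity n
...   | even a = tm-pair a
...   | odd a  = subst (Flips tm) x+k≡n (from (Periodic⇒Flips⇔ tm per k<L)
  (subst (Flips tm) (sym shifted-even) (tm-pair (suc (a + c)))))
  where
  shifted-even : x + suc (2 * c) + k ≡ 2 * suc (a + c)
  shifted-even = begin
    x + suc (2 * c) + k      ≡⟨ regroup x c k ⟩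
    (x + k) + suc (2 * c)    ≡⟨ cong (_+ suc (2 * c)) x+k≡n ⟩
    suc (2 * a) + suc (2 * c) ≡⟨ sum a c ⟩
    2 * suc (a + c)          ∎
    where
    open ≡-Reasoning
    regroup : ∀ x c k → x + suc (2 * c) + k ≡ (x + k) + suc (2 * c)
    regroup = solve-∀
    sum : ∀ a c → suc (2 * a) + suc (2 * c) ≡ 2 * suc (a + c)
    sum = solve-∀

no-cube : ∀ {x} → ¬ Periodic tm x 1 2
no-cube {x} per with parity x
... | even a = Flips⇒¬Periodic-1 tm (tm-pair a) (Agree-≤ tm (n≤1+n 1) per)
... | odd a  = Flips⇒¬Periodic-1 tm (tm-pair (suc a))
  (subst (λ y → Periodic tm y 1 1) (sym (*-suc 2 a)) (Periodic-suc tm per))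

-- Even periods halve; an odd period p ≥ 3 makes 2p + 1 consecutive letters alternate, which
-- is an overlap of period 2.
overlap-free : ∀ p → 1 ≤ p → ∀ x → ¬ Periodic tm x p (suc p)
overlap-free _ = go (<-wellFounded _)
  where
  go : ∀ {p} → Acc _<_ p → 1 ≤ p → ∀ x → ¬ Periodic tm x p (suc p)
  go {p} (acc rec) 1≤p x per with parity p
  go (acc rec) () x per | even zero
  ... | even (suc b) with parity x
  ...   | even a = go (rec (m<m+n (suc b) z<s)) z<s a (halve-even {a} {suc b} {suc b} per)
  ...   | odd a  = go (rec (m<m+n (suc b) z<s)) z<s a (halve-odd {a} {suc b} {b} (Agree-≤ tm (n≤1+n _) per))
  go (acc rec) 1≤p x per | odd zero = no-cube per
  go (acc rec) 1≤p x per | odd (suc c) =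
    go (rec 3≤p) z<s x (Alternating⇒Periodic tm {x} (Alternating-≤ tm {x} 4≤p+p
      (Alternating-++ tm {x} {p} alt (Alternating-shift tm {x} {p} per alt))))
    where
    p = suc (2 * suc c)
    3≤p : 3 ≤ p
    3≤p = s≤s (*-monoʳ-≤ 2 (s≤s z≤n))
    4≤p+p : 4 ≤ p + p
    4≤p+p = ≤-trans (m≤m+n 4 2) (+-mono-≤ 3≤p 3≤p)
    alt : Alternating tm x p
    alt = odd-period⇒Alternating {x} {suc c} per

no-square-centred-at-odd : ∀ {s ℓ c} → 1 ≤ ℓ → s + ℓ ≡ suc (2 * c) → ¬ Periodic tm s ℓ ℓ
no-square-centred-at-odd {s} {ℓ} {c} 1≤ℓ centre per with parity s | parity ℓ
... | even a | even b = even≢odd (a + b) c (trans (*-distribˡ-+ 2 a b) centre)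
... | odd a  | odd b  = even≢odd (suc (a + b)) c (trans (sum a b) centre)
  where
  sum : ∀ a b → 2 * suc (a + b) ≡ suc (2 * a) + suc (2 * b)
  sum = solve-∀
no-square-centred-at-odd () _ _ | odd a | even zero
... | odd a  | even (suc b) = overlap-free (suc b) z<s a (halve-odd {a} {suc b} {b} per)
... | even a | odd zero     = Flips⇒¬Periodic-1 tm (tm-pair a) per
... | even a | odd (suc d)  = overlap-free 2 z<s (2 * a)
  (Alternating⇒Periodic tm {2 * a} (Alternating-≤ tm {2 * a} 4≤ (Alternating-++ tm {2 * a} before after)))
  where
  centre-flips : Alternating tm (2 * a + 2 * suc d) 1
  centre-flips zero _ = subst (Flips tm) (trans (*-distribˡ-+ 2 a (suc d)) (sym (+-identityʳ _))) (tm-pair (a + suc d))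
  centre-flips (suc _) (s≤s ())
  before : Alternating tm (2 * a) (2 * suc d + 1)
  before = Alternating-++ tm {2 * a} (odd-period⇒Alternating {2 * a} {suc d} per) centre-flips
  after : Alternating tm (2 * a + (2 * suc d + 1)) (2 * suc d)
  after = subst (λ y → Alternating tm (2 * a + y) (2 * suc d)) (+-comm 1 (2 * suc d))
    (Alternating-shift tm {2 * a} {suc (2 * suc d)} per (odd-period⇒Alternating {2 * a} {suc d} per))
  4≤ : 4 ≤ 2 * suc d + 1 + 2 * suc d
  4≤ = ≤-trans (n≤1+n 4) (+-mono-≤ (+-monoˡ-≤ 1 2≤2d) 2≤2d)
    where
    2≤2d : 2 ≤ 2 * suc d
    2≤2d = *-monoʳ-≤ 2 (s≤s z≤n)

-- An odd m would put tm 1 = tm 2 on the block starting at the even position m + 1.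
prefix-occurrence-aligned : ∀ k {m} → Periodic tm 0 m (suc (2 ^ k)) → 2 ^ k ∣ m
prefix-occurrence-aligned zero    {m} _ = 1∣ m
prefix-occurrence-aligned (suc k) {m} per with parity m
... | even b = *-monoʳ-∣ 2 (prefix-occurrence-aligned k (halve-even {0} {b} per))
... | odd b  = ⊥-elim (not-¬ refl (trans tm[2+2b]≡tm[3+2b] (tm-pair (suc b))))
  where
  2≤2P : 2 ≤ 2 * 2 ^ k
  2≤2P = *-monoʳ-≤ 2 (m^n>0 2 k)
  tm[2+2b]≡tm[3+2b] : tm (2 * suc b) ≡ tm (suc (2 * suc b))
  tm[2+2b]≡tm[3+2b] = begin
    tm (2 * suc b)           ≡⟨ cong tm (shift₁ b) ⟩
    tm (suc (2 * b) + 1)     ≡⟨ per .at 1 (s≤s (≤-trans (s≤s z≤n) 2≤2P)) ⟨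
    tm 1                     ≡⟨⟩
    tm 2                     ≡⟨ per .at 2 (s≤s 2≤2P) ⟩
    tm (suc (2 * b) + 2)     ≡⟨ cong tm (shift₂ b) ⟩
    tm (suc (2 * suc b))     ∎
    where
    open ≡-Reasoning
    shift₁ : ∀ b → 2 * suc b ≡ suc (2 * b) + 1
    shift₁ = solve-∀
    shift₂ : ∀ b → suc (2 * b) + 2 ≡ suc (2 * suc b)
    shift₂ = solve-∀

prefix-recurs-at-3·2^k : ∀ k → Periodic tm 0 (3 * 2 ^ k) (2 ^ suc k)
prefix-recurs-at-3·2^k k .at j j<2P with j <? 2 ^ k
... | yes j<P = sym (tm-xor k 3 j j<P)
... | no j≮P = begin
  tm j                    ≡⟨ cong tm P+d≡j ⟨
  tm (2 ^ k + d)          ≡⟨ cong tm (cong (_+ d) (*-identityˡ (2 ^ k))) ⟨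
  tm (1 * 2 ^ k + d)      ≡⟨ tm-xor k 1 d d<P ⟩
  not (tm d)              ≡⟨ tm-xor k 4 d d<P ⟨
  tm (4 * 2 ^ k + d)      ≡⟨ cong tm (regroup (2 ^ k) d) ⟩
  tm (3 * 2 ^ k + (2 ^ k + d)) ≡⟨ cong (λ i → tm (3 * 2 ^ k + i)) P+d≡j ⟩
  tm (3 * 2 ^ k + j)      ∎
  where
  open ≡-Reasoning
  d = j ∸ 2 ^ k
  P+d≡j : 2 ^ k + d ≡ j
  P+d≡j = m+[n∸m]≡n (≮⇒≥ j≮P)
  d<P : d < 2 ^ k
  d<P = +-cancelˡ-< (2 ^ k) d (2 ^ k) (subst (_< 2 ^ k + 2 ^ k) (sym P+d≡j)
    (subst (j <_) (cong (2 ^ k +_) (+-identityʳ (2 ^ k))) j<2P))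
  regroup : ∀ P d → 4 * P + d ≡ 3 * P + (P + d)
  regroup = solve-∀

binary-magnitude : ∀ n → ∃ λ k → 2 ^ k ≤ suc n × suc n < 2 ^ suc k
binary-magnitude zero    = 0 , ≤-refl , s≤s (s≤s z≤n)
binary-magnitude (suc n) with binary-magnitude n
... | k , lo , hi with suc (suc n) <? 2 ^ suc k
...   | yes hi′ = k , m≤n⇒m≤1+n lo , hi′
...   | no  hi̸  = suc k , ≮⇒≥ hi̸ , ≤-<-trans hi P<2P
  where
  P<2P : 2 ^ suc k < 2 * 2 ^ suc k
  P<2P = m<m+n (2 ^ suc k) (subst (0 <_) (sym (+-identityʳ _)) (m^n>0 2 (suc k)))

odd-prefix-occurrence-aligned : ∀ k a {m} → 2 ^ k ≤ suc (2 * a) → Periodic tm 0 m (suc (2 * a)) → 2 ^ k ∣ m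
odd-prefix-occurrence-aligned zero    a {m} _  _   = 1∣ m
odd-prefix-occurrence-aligned (suc k) a     lo per = prefix-occurrence-aligned (suc k) (Agree-≤ tm P<i per)
  where
  P<i : 2 ^ suc k < suc (2 * a)
  P<i = ≤∧≢⇒< lo (even≢odd (2 ^ k) a)

odd-prefix-recurrence-≥3·2^k : ∀ k a m → 2 ^ k ≤ suc (2 * a) → suc (2 * a) ≤ m →
                         Periodic tm 0 m (suc (2 * a)) → 3 * 2 ^ k ≤ m
odd-prefix-recurrence-≥3·2^k k a m lo i≤m per with m≤n⇒m<n∨m≡n i≤m
... | inj₂ refl = ⊥-elim (no-square-centred-at-odd {c = a} z<s refl per)
... | inj₁ i<m  with odd-prefix-occurrence-aligned k a lo per
...   | divides zero refl                   = ⊥-elim (n≮0 i<m)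
...   | divides (suc zero) refl             = ⊥-elim (≤⇒≯ lo (subst (suc (2 * a) <_) (+-identityʳ (2 ^ k)) i<m))
...   | divides (suc (suc zero)) refl       = contradiction (trans (per .at 0 z<s) (tm-xor k 2 0 (m^n>0 2 k))) λ ()
...   | divides (suc (suc (suc q))) refl    = *-monoˡ-≤ (2 ^ k) (s≤s (s≤s (s≤s (z≤n {q}))))

-- The periodicity function of t

square⇒Admissible : ∀ {s ℓ i} → 1 ≤ ℓ → s + ℓ ≡ i → Periodic tm s ℓ ℓ → Admissible t i ℓ
square⇒Admissible {s} {ℓ} {i} 1≤ℓ s+ℓ≡i per =
  1≤ℓ , inj₁ (from (suffix-of-prefix⇔square t i ℓ) (s , s+ℓ≡i , from (Agree-t⇔tm s (s + ℓ) ℓ) per))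

module _ (w : ℕ → ℕ) {i : ℕ} where

  IsPeriodicity-unique : ∀ {ℓ ℓ′} → IsPeriodicity w i ℓ → IsPeriodicity w i ℓ′ → ℓ ≡ ℓ′
  IsPeriodicity-unique (adm , least) (adm′ , least′) = ≤-antisym (least _ adm′) (least′ _ adm)

  IsPeriodicity-1 : Admissible w i 1 → IsPeriodicity w i 1
  IsPeriodicity-1 adm = adm , λ _ adm′ → proj₁ adm′

  IsPeriodicity-2 : ¬ Admissible w i 1 → Admissible w i 2 → IsPeriodicity w i 2
  IsPeriodicity-2 ¬adm₁ adm₂ = adm₂ , least
    where
    least : ∀ m → Admissible w i m → 2 ≤ m
    least zero          (() , _)
    least (suc zero)    adm = ⊥-elim (¬adm₁ adm)
    least (suc (suc m)) _   = s≤s (s≤s z≤n)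

periodicity-odd : ∀ k a → 2 ^ k ≤ suc (2 * a) → suc (2 * a) < 2 ^ suc k →
                  IsPeriodicity t (suc (2 * a)) (3 * 2 ^ k)
periodicity-odd k a lo hi = (1≤3P , inj₂ recurs) , least
  where
  i = suc (2 * a)
  1≤3P : 1 ≤ 3 * 2 ^ k
  1≤3P = ≤-trans (m^n>0 2 k) (m≤m+n (2 ^ k) _)
  i≤3P : i ≤ 3 * 2 ^ k
  i≤3P = ≤-trans (<⇒≤ hi) (*-monoˡ-≤ (2 ^ k) (n≤1+n 2))
  recurs : IsSuffix (prefix t i) (factor t i (3 * 2 ^ k))
  recurs = from (prefix-is-suffix⇔recurrence t i (3 * 2 ^ k))
    (i≤3P , from (Agree-t⇔tm 0 (3 * 2 ^ k) i) (Agree-≤ tm (<⇒≤ hi) (prefix-recurs-at-3·2^k k)))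
  least : ∀ m → Admissible t i m → 3 * 2 ^ k ≤ m
  least m (1≤m , inj₁ suffix) with to (suffix-of-prefix⇔square t i m) suffix
  ... | s , s+m≡i , per = ⊥-elim (no-square-centred-at-odd {c = a} 1≤m s+m≡i (to (Agree-t⇔tm s (s + m) m) per))
  least m (1≤m , inj₂ prefix) with to (prefix-is-suffix⇔recurrence t i m) prefix
  ... | i≤m , per = odd-prefix-recurrence-≥3·2^k k a m lo i≤m (to (Agree-t⇔tm 0 m i) per)

periodicity-even : ∀ a → ∃ λ ℓ → IsPeriodicity t (2 * a) ℓ × ℓ ≤ 2
periodicity-even zero = 1 , IsPeriodicity-1 t (≤-refl , inj₂ empty-prefix) , s≤s z≤n
  where
  empty-prefix : IsSuffix (prefix t 0) (factor t 0 1)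
  empty-prefix = from (prefix-is-suffix⇔recurrence t 0 1) (z≤n , agree λ _ ())
periodicity-even (suc a) with tm (suc (2 * a)) ≟ᵇ tm (suc (suc (2 * a)))
... | yes eq  = 1 , IsPeriodicity-1 t (square⇒Admissible z<s centre (from (Periodic-1⇔ tm) eq)) , s≤s z≤n
  where
  centre : suc (2 * a) + 1 ≡ 2 * suc a
  centre = trans (+-comm (suc (2 * a)) 1) (sym (*-suc 2 a))
... | no  neq = 2 , IsPeriodicity-2 t ¬adm₁ adm₂ , ≤-refl
  where
  ¬adm₁ : ¬ Admissible t (2 * suc a) 1
  ¬adm₁ (_ , inj₁ suffix) with to (suffix-of-prefix⇔square t _ 1) suffix
  ... | s , s+1≡i , per =
    neq (subst (λ y → tm y ≡ tm (suc y)) s≡1+2a (to (Periodic-1⇔ tm) (to (Agree-t⇔tm s (s + 1) 1) per)))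
    where
    s≡1+2a : s ≡ suc (2 * a)
    s≡1+2a = suc-injective (trans (+-comm 1 s) (trans s+1≡i (*-suc 2 a)))
  ¬adm₁ (_ , inj₂ prefix) =
    ≤⇒≯ (proj₁ (to (prefix-is-suffix⇔recurrence t _ 1) prefix)) (*-monoʳ-≤ 2 (s≤s z≤n))
  adm₂ : Admissible t (2 * suc a) 2
  adm₂ = square⇒Admissible z<s (trans (+-comm (2 * a) 2) (sym (*-suc 2 a))) (Alternating⇒Periodic tm alternating)
    where
    alternating : Alternating tm (2 * a) 3
    alternating zero                   _ = subst (Flips tm) (sym (+-identityʳ (2 * a))) (tm-pair a)
    alternating (suc zero)             _ = subst (Flips tm) (+-comm 1 (2 * a)) (¬-not (neq ∘ sym))
    alternating (suc (suc zero))       _ = subst (Flips tm) (+-comm 2 (2 * a)) (subst (Flips tm) (*-suc 2 a) (tm-pair (suc a)))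
    alternating (suc (suc (suc _))) (s≤s (s≤s (s≤s ())))

periodicity : ∀ i → ∃ (IsPeriodicity t i)
periodicity i with parity i
... | even a with periodicity-even a
...   | ℓ , per , _ = ℓ , per
periodicity i | odd a with binary-magnitude (2 * a)
...   | k , lo , hi = 3 * 2 ^ k , periodicity-odd k a lo hi

periodicity-even-≤2 : ∀ {a ℓ} → IsPeriodicity t (2 * a) ℓ → ℓ ≤ 2
periodicity-even-≤2 {a} per with periodicity-even a
... | ℓ′ , per′ , ℓ′≤2 = subst (_≤ 2) (IsPeriodicity-unique t per′ per) ℓ′≤2

periodicity-odd-bounds : ∀ {a ℓ} → IsPeriodicity t (suc (2 * a)) ℓ → 3 * suc a ≤ ℓ × ℓ ≤ 3 * suc (2 * a)
periodicity-odd-bounds {a} per with binary-magnitude (2 * a)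
... | k , lo , hi = subst (λ ℓ → 3 * suc a ≤ ℓ × ℓ ≤ 3 * suc (2 * a))
  (IsPeriodicity-unique t (periodicity-odd k a lo hi) per)
  (*-monoʳ-≤ 3 {suc a} {2 ^ k} 1+a≤P , *-monoʳ-≤ 3 {2 ^ k} {suc (2 * a)} lo)
  where
  1+a≤P : suc a ≤ 2 ^ k
  1+a≤P = *-cancelˡ-≤ 2 (subst (_≤ 2 * 2 ^ k) (sym (*-suc 2 a)) hi)

-- Summation

module _ (f : ℕ → ℕ) where

  sumTo-2*suc : ∀ m → sumTo f (2 * suc m) ≡ sumTo f (2 * m) + f (2 * m) + f (suc (2 * m))
  sumTo-2*suc m = cong (sumTo f) (*-suc 2 m)

  module _ (even-≥ : ∀ a → 1 ≤ f (2 * a)) (odd-≥ : ∀ a → 3 * suc a ≤ f (suc (2 * a))) where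

    sumTo-2*-≥ : ∀ m → 3 * (m * m) + 5 * m ≤ 2 * sumTo f (2 * m)
    sumTo-2*-≥ zero    = z≤n
    sumTo-2*-≥ (suc m) = begin
      3 * (suc m * suc m) + 5 * suc m                                   ≡⟨ expand m ⟩
      (3 * (m * m) + 5 * m) + 2 * 1 + 2 * (3 * suc m)                   ≤⟨ +-mono-≤ (+-mono-≤ (sumTo-2*-≥ m)
                                                                             (*-monoʳ-≤ 2 (even-≥ m))) (*-monoʳ-≤ 2 (odd-≥ m)) ⟩
      2 * sumTo f (2 * m) + 2 * f (2 * m) + 2 * f (suc (2 * m))         ≡⟨ collect (sumTo f (2 * m)) (f (2 * m)) (f (suc (2 * m))) ⟩
      2 * (sumTo f (2 * m) + f (2 * m) + f (suc (2 * m)))               ≡⟨ cong (2 *_) (sumTo-2*suc m) ⟨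
      2 * sumTo f (2 * suc m)                                           ∎
      where
      open ≤-Reasoning
      expand : ∀ m → 3 * (suc m * suc m) + 5 * suc m ≡ (3 * (m * m) + 5 * m) + 2 * 1 + 2 * (3 * suc m)
      expand = solve-∀
      collect : ∀ x y z → 2 * x + 2 * y + 2 * z ≡ 2 * (x + y + z)
      collect = solve-∀

    sumTo-≥ : ∀ n → 3 * ((n ∸ 1) * (n ∸ 1)) + 4 * n ≤ 8 * sumTo f n
    sumTo-≥ n with parity n
    ... | even zero    = z≤n
    ... | even (suc m) = begin
      3 * ((2 * suc m ∸ 1) * (2 * suc m ∸ 1)) + 4 * (2 * suc m)  ≡⟨ cong (λ x → 3 * (x * x) + 4 * (2 * suc m)) (cong (_∸ 1) (*-suc 2 m)) ⟩
      3 * (suc (2 * m) * suc (2 * m)) + 4 * (2 * suc m)          ≤⟨ ≤-by-slack (24 * m + 21) (expand m) ⟩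
      4 * (3 * (suc m * suc m) + 5 * suc m)                      ≤⟨ *-monoʳ-≤ 4 (sumTo-2*-≥ (suc m)) ⟩
      4 * (2 * sumTo f (2 * suc m))                              ≡⟨ *-assoc 4 2 (sumTo f (2 * suc m)) ⟨
      8 * sumTo f (2 * suc m)                                    ∎
      where
      open ≤-Reasoning
      expand : ∀ m → 3 * (suc (2 * m) * suc (2 * m)) + 4 * (2 * suc m) + (24 * m + 21) ≡ 4 * (3 * (suc m * suc m) + 5 * suc m)
      expand = solve-∀
    ... | odd m = begin
      3 * (2 * m * (2 * m)) + 4 * suc (2 * m)                    ≤⟨ ≤-by-slack (12 * m + 4) (expand m) ⟩
      4 * (3 * (m * m) + 5 * m + 2 * 1)                          ≤⟨ *-monoʳ-≤ 4 (+-mono-≤ (sumTo-2*-≥ m) (*-monoʳ-≤ 2 (even-≥ m))) ⟩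
      4 * (2 * sumTo f (2 * m) + 2 * f (2 * m))                  ≡⟨ collect (sumTo f (2 * m)) (f (2 * m)) ⟩
      8 * (sumTo f (2 * m) + f (2 * m))                          ∎
      where
      open ≤-Reasoning
      expand : ∀ m → 3 * (2 * m * (2 * m)) + 4 * suc (2 * m) + (12 * m + 4) ≡ 4 * (3 * (m * m) + 5 * m + 2 * 1)
      expand = solve-∀
      collect : ∀ x y → 4 * (2 * x + 2 * y) ≡ 8 * (x + y)
      collect = solve-∀

  module _ (even-≤ : ∀ a → f (2 * a) ≤ 2) (odd-≤ : ∀ a → f (suc (2 * a)) ≤ 3 * suc (2 * a)) where

    sumTo-2*-≤ : ∀ m → sumTo f (2 * m) ≤ 3 * (m * m) + 2 * m
    sumTo-2*-≤ zero    = z≤n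
    sumTo-2*-≤ (suc m) = begin
      sumTo f (2 * suc m)                                  ≡⟨ sumTo-2*suc m ⟩
      sumTo f (2 * m) + f (2 * m) + f (suc (2 * m))        ≤⟨ +-mono-≤ (+-mono-≤ (sumTo-2*-≤ m) (even-≤ m)) (odd-≤ m) ⟩
      3 * (m * m) + 2 * m + 2 + 3 * suc (2 * m)            ≡⟨ expand m ⟩
      3 * (suc m * suc m) + 2 * suc m                      ∎
      where
      open ≤-Reasoning
      expand : ∀ m → 3 * (m * m) + 2 * m + 2 + 3 * suc (2 * m) ≡ 3 * (suc m * suc m) + 2 * suc m
      expand = solve-∀

    sumTo-≤ : ∀ n → 4 * sumTo f n ≤ 3 * (n * n) + 4 * n + 4
    sumTo-≤ n with parity n
    ... | even m = begin
      4 * sumTo f (2 * m)                                  ≤⟨ *-monoʳ-≤ 4 (sumTo-2*-≤ m) ⟩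
      4 * (3 * (m * m) + 2 * m)                            ≤⟨ ≤-by-slack 4 (expand m) ⟩
      3 * (2 * m * (2 * m)) + 4 * (2 * m) + 4              ∎
      where
      open ≤-Reasoning
      expand : ∀ m → 4 * (3 * (m * m) + 2 * m) + 4 ≡ 3 * (2 * m * (2 * m)) + 4 * (2 * m) + 4
      expand = solve-∀
    ... | odd m = begin
      4 * (sumTo f (2 * m) + f (2 * m))                    ≤⟨ *-monoʳ-≤ 4 (+-mono-≤ (sumTo-2*-≤ m) (even-≤ m)) ⟩
      4 * (3 * (m * m) + 2 * m + 2)                        ≤⟨ ≤-by-slack (12 * m + 3) (expand m) ⟩
      3 * (suc (2 * m) * suc (2 * m)) + 4 * suc (2 * m) + 4 ∎
      where
      open ≤-Reasoning
      expand : ∀ m → 4 * (3 * (m * m) + 2 * m + 2) + (12 * m + 3) ≡ 3 * (suc (2 * m) * suc (2 * m)) + 4 * suc (2 * m) + 4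
      expand = solve-∀

proposition2 : ∀ (n : ℕ) → 1 ≤ n →
    ∃ λ (p : ℕ → ℕ) → (∀ i → i < n → IsPeriodicity t i (p i)) ×
      (3 * ((n ∸ 1) * (n ∸ 1)) + 4 * n ≤ 8 * sumTo p n) ×
      (4 * sumTo p n ≤ 3 * (n * n) + 4 * n + 4)
proposition2 n _ = p , (λ i _ → p-correct i) , sumTo-≥ p even-≥ odd-≥ n , sumTo-≤ p even-≤ odd-≤ n
  where
  p : ℕ → ℕ
  p i = proj₁ (periodicity i)
  p-correct : ∀ i → IsPeriodicity t i (p i)
  p-correct i = proj₂ (periodicity i)
  even-≥ : ∀ a → 1 ≤ p (2 * a)
  even-≥ a = proj₁ (proj₁ (p-correct (2 * a)))
  even-≤ : ∀ a → p (2 * a) ≤ 2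
  even-≤ a = periodicity-even-≤2 {a} (p-correct (2 * a))
  odd-≥ : ∀ a → 3 * suc a ≤ p (suc (2 * a))
  odd-≥ a = proj₁ (periodicity-odd-bounds {a} (p-correct (suc (2 * a))))
  odd-≤ : ∀ a → p (suc (2 * a)) ≤ 3 * suc (2 * a)
  odd-≤ a = proj₂ (periodicity-odd-bounds {a} (p-correct (suc (2 * a))))
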